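{- Let $T$ be a tree on $n>3$ vertices, and suppose there exist two leaves $u$ and $v$ of $T$ adjacent to the same vertex. Then $$\mathrm{rank}(\mathrm{Max4PC}_T)=\mathrm{rank}(\mathrm{Max4PC}_{T-u})=\mathrm{rank}(\mathrm{Max4PC}_{T-v}).$$
   Context: For a tree $T$ and vertices $x,y$, $d_{x,y}$ denotes the distance between $x$ and $y$ in $T$. For a tree $T$, $\mathrm{Max4PC}_T$ is the matrix with rows and columns indexed by unordered pairs of distinct vertices of $T$, with entry in row $\{w,x\}$ and column $\{y,z\}$ equal to $\max\{d_{w,x}+d_{y,z},\ d_{w,y}+d_{x,z},\ d_{w,z}+d_{x,y}\}$. $T-u$ is the tree obtained by deleting the leaf $u$. -}

module Defs where

open import Data.Nat as ℕ using (ℕ; zero; suc; _⊔_)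
open import Data.Integer using (+_)
open import Data.Fin as Fin using (Fin; punchIn; _<_; inject₁; fromℕ)
open import Data.Bool using (Bool; true; false; _∨_; _∧_; if_then_else_)
open import Data.Product using (Σ; ∃; _×_; _,_)
open import Data.Rational as ℚ using (ℚ; 0ℚ; _/_)
open import Relation.Binary.PropositionalEquality using (_≡_)
open import Relation.Nullary using (¬_)
open import Relation.Nullary.Decidable using (⌊_⌋)
open import Function.Definitions using (Injective)

record Graph (n : ℕ) : Set where
  field
    adj    : Fin n → Fin n → Bool
    sym    : ∀ x y → adj x y ≡ adj y x
    irrefl : ∀ x → adj x x ≡ false
open Graph public

anyF : ∀ {n} → (Fin n → Bool) → Bool
anyF {zero}  p = false
anyF {suc n} p = p Fin.zero ∨ anyF (λ i → p (Fin.suc i))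

reach : ∀ {n} → Graph n → ℕ → Fin n → Fin n → Bool
reach G zero    x y = ⌊ x Fin.≟ y ⌋
reach G (suc k) x y = reach G k x y ∨ anyF (λ z → reach G k x z ∧ adj G z y)

-- least k in [s, s+fuel) with p k, or s+fuel if none
leastFrom : ℕ → ℕ → (ℕ → Bool) → ℕ
leastFrom s zero     p = s
leastFrom s (suc f)  p = if p s then s else leastFrom (suc s) f p

-- graph distance: length of a shortest walk (every shortest walk has length < n)
dist : ∀ {n} → Graph n → Fin n → Fin n → ℕ
dist {n} G x y = leastFrom 0 n (λ k → reach G k x y)

Connected : ∀ {n} → Graph n → Set
Connected G = ∀ x y → ∃ λ k → reach G k x y ≡ true

-- a cycle: k+3 distinct vertices, consecutive ones adjacent, last adjacent to first
HasCycle : ∀ {n} → Graph n → Set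
HasCycle {n} G = ∃ λ k → Σ (Fin (suc (suc (suc k))) → Fin n) λ f →
  Injective _≡_ _≡_ f
  × (∀ (i : Fin (suc (suc k))) → adj G (f (inject₁ i)) (f (Fin.suc i)) ≡ true)
  × adj G (f (fromℕ (suc (suc k)))) (f Fin.zero) ≡ true

IsTree : ∀ {n} → Graph n → Set
IsTree G = Connected G × ¬ HasCycle G

LeafAt : ∀ {n} → Graph n → Fin n → Fin n → Set
LeafAt G u w = adj G u w ≡ true × (∀ z → adj G u z ≡ true → z ≡ w)

-- G - u : delete vertex u (remaining vertices re-indexed by punchIn u)
delete : ∀ {m} → Graph (suc m) → Fin (suc m) → Graph m
delete G u = record
  { adj    = λ i j → adj G (punchIn u i) (punchIn u j)
  ; sym    = λ i j → sym G (punchIn u i) (punchIn u j)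
  ; irrefl = λ i → irrefl G (punchIn u i)
  }

-- unordered pairs of distinct vertices, represented as (i , j) with i < j
Pair : ℕ → Set
Pair n = Σ (Fin n) λ i → Σ (Fin n) λ j → i < j

max3 : ℕ → ℕ → ℕ → ℕ
max3 a b c = a ⊔ b ⊔ c

Max4PC : ∀ {n} → Graph n → Pair n → Pair n → ℕ
Max4PC G (w , x , _) (y , z , _) =
  max3 (dist G w x ℕ.+ dist G y z) (dist G w y ℕ.+ dist G x z) (dist G w z ℕ.+ dist G x y)

toℚ : ℕ → ℚ
toℚ k = (+ k) / 1

sumF : ∀ {r} → (Fin r → ℚ) → ℚ
sumF {zero}  f = 0ℚ
sumF {suc r} f = f Fin.zero ℚ.+ sumF (λ i → f (Fin.suc i))

LinIndepRows : ∀ {P : Set} → (P → P → ℕ) → ∀ {r} → (Fin r → P) → Set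
LinIndepRows {P} M rows = ∀ (c : Fin _ → ℚ) →
  (∀ (q : P) → sumF (λ k → c k ℚ.* toℚ (M (rows k) q)) ≡ 0ℚ) → ∀ k → c k ≡ 0ℚ

HasRank : ∀ {P : Set} → (P → P → ℕ) → ℕ → Set
HasRank {P} M r =
  (Σ (Fin r → P) λ rows → LinIndepRows M rows)
  × (∀ (rows : Fin (suc r) → P) → ¬ LinIndepRows M rows)

-- For a leaf u hanging at w, d(u, y) = 1 + d(w, y) for every vertex y ≠ u. For twin leaves u and v
-- at w this makes row {u, b} of Max4PC equal to row {v, b} when b ∉ {u, v}, and gives
-- row {u, v} = row {v, w} + row {v, x} − row {w, x} for any fourth vertex x. So every row of Max4PC_T
-- lies in the span of the rows avoiding u; since deleting a leaf preserves distances, those rows make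
-- up the principal submatrix Max4PC_{T−u}. If the rows of a symmetric matrix indexed by a set S span
-- all of its rows, its principal submatrix on S has the same rank. Exchanging u and v handles T − v.

module Submission where

open import Defs hiding (sym)
open import Data.Nat using (ℕ; suc; _≤_; z≤n; s≤s)
open import Data.Fin using (Fin; zero; suc)
open import Data.Product using (∃; _×_; _,_)
open import Function using (_∘_)
open import Relation.Binary.PropositionalEquality using (_≢_; sym)

module LinearAlgebra where
  open import Level using (0ℓ)
  open import Data.Nat as ℕ using (ℕ; zero; suc; _≤_; _<_; z≤n; s≤s)
  import Data.Nat.Properties as ℕ
  open import Data.Fin as Fin using (Fin; zero; suc; punchIn)
  import Data.Fin.Properties as Fin
  open import Data.Vec.Functional using (_∷_; removeAt; insertAt)
  open import Data.Vec.Functional.Properties using (insertAt-lookup; insertAt-punchIn)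
  open import Data.Rational using (ℚ; 0ℚ; 1ℚ; _+_; _*_; -_; _-_; 1/_; _≟_; NonZero; ≢-nonZero; _/_; mkℚ)
  import Data.Integer as ℤ
  import Data.Integer.Properties as ℤ
  open import Data.Nat.Coprimality using (1-coprimeTo) renaming (sym to coprime-sym)
  open import Data.Rational.Properties
    using ( normalize-coprime; +-*-commutativeRing; 1≢0; *-zeroˡ; *-zeroʳ; *-identityˡ; *-identityʳ; *-assoc
          ; *-distribʳ-+; +-identityʳ; +-identityˡ; +-inverseˡ; *-inverseˡ; *-inverseʳ)
  open import Algebra.Bundles using (CommutativeRing)
  open import Algebra.Properties.Semiring.Sum (CommutativeRing.semiring +-*-commutativeRing)
    using (sum; sum-syntax; sum-cong-≗; sum-replicate-zero; sum-remove; ∑-distrib-+; ∑-comm; *-distribˡ-sum; *-distribʳ-sum)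
  open import Data.Product using (∃; Σ-syntax; _×_; _,_; proj₁; proj₂)
  open import Data.Sum using (_⊎_; inj₁; inj₂)
  import Data.Sum as Sum
  import Data.Product as Product
  open import Data.Empty using (⊥-elim)
  open import Function using (_∘_)
  open import Relation.Nullary using (¬_; yes; no)
  open import Relation.Nullary.Decidable using (¬?; decidable-stable; dec⇒maybe)
  open import Relation.Binary.PropositionalEquality
  open import Tactic.RingSolver using (solve-∀)
  open import Tactic.RingSolver.Core.AlmostCommutativeRing using (AlmostCommutativeRing; fromCommutativeRing)

  ℚ-ring : AlmostCommutativeRing 0ℓ 0ℓ
  ℚ-ring = fromCommutativeRing +-*-commutativeRing (λ x → dec⇒maybe (0ℚ ≟ x))

  private
    variable
      Q : Set
      s t L : ℕ

  sumF≡sum : ∀ {n} (f : Fin n → ℚ) → sumF f ≡ sum f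
  sumF≡sum {zero}  f = refl
  sumF≡sum {suc n} f = cong (f zero +_) (sumF≡sum (f ∘ suc))

  sum-zero : ∀ {n} {f : Fin n → ℚ} → (∀ i → f i ≡ 0ℚ) → sum f ≡ 0ℚ
  sum-zero {n} f≗0 = trans (sum-cong-≗ f≗0) (sum-replicate-zero n)

  ∑-∑-*ˡ : ∀ (c : Fin s → ℚ) (x : Fin s → Fin t → ℚ) →
    ∑[ k < s ] (c k * ∑[ j < t ] x k j) ≡ ∑[ j < t ] ∑[ k < s ] (c k * x k j)
  ∑-∑-*ˡ c x = trans (sum-cong-≗ (λ k → *-distribˡ-sum (c k) (x k))) (∑-comm (λ k j → c k * x k j))

  lincomb : (Fin s → ℚ) → (Fin s → Q → ℚ) → Q → ℚ
  lincomb {s} c f q = ∑[ k < s ] (c k * f k q)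

  Independent : (Fin s → Q → ℚ) → Set
  Independent f = ∀ c → (∀ q → lincomb c f q ≡ 0ℚ) → ∀ k → c k ≡ 0ℚ

  Dependent : (Fin s → Q → ℚ) → Set
  Dependent f = ∃ λ c → (∀ q → lincomb c f q ≡ 0ℚ) × ∃ λ k → c k ≢ 0ℚ

  _∈Span_ : (Q → ℚ) → (Fin t → Q → ℚ) → Set
  v ∈Span g = ∃ λ a → ∀ q → v q ≡ lincomb a g q

  dependent⇒¬independent : {f : Fin s → Q → ℚ} → Dependent f → ¬ Independent f
  dependent⇒¬independent (c , c·f≡0 , k , cₖ≢0) ind = cₖ≢0 (ind c c·f≡0 k)

  lincomb-removeAt : ∀ (c : Fin (suc s) → ℚ) (f : Fin (suc s) → Q → ℚ) k q →
    lincomb c f q ≡ c k * f k q + lincomb (removeAt c k) (removeAt f k) q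
  lincomb-removeAt c f k q = sum-remove (λ i → c i * f i q)

  lincomb-lincomb : ∀ (c : Fin s → ℚ) (a : Fin s → Fin t → ℚ) (g : Fin t → Q → ℚ) q →
    lincomb c (λ k → lincomb (a k) g) q ≡ lincomb (λ j → ∑[ k < s ] (c k * a k j)) g q
  lincomb-lincomb {s} {t} c a g q = begin
    ∑[ k < s ] (c k * ∑[ j < t ] (a k j * g j q))
      ≡⟨ ∑-∑-*ˡ c (λ k j → a k j * g j q) ⟩
    ∑[ j < t ] ∑[ k < s ] (c k * (a k j * g j q))
      ≡⟨ sum-cong-≗ (λ j → sum-cong-≗ (λ k → assoc (c k) (a k j) (g j q))) ⟩
    ∑[ j < t ] ∑[ k < s ] ((c k * a k j) * g j q)
      ≡⟨ sum-cong-≗ (λ j → sym (*-distribʳ-sum (g j q) (λ k → c k * a k j))) ⟩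
    ∑[ j < t ] (∑[ k < s ] (c k * a k j) * g j q) ∎
    where
    open ≡-Reasoning
    assoc : ∀ x y z → x * (y * z) ≡ (x * y) * z
    assoc = solve-∀ ℚ-ring

  -- Gaussian elimination

  *-1/-cancelʳ : ∀ x p .{{_ : NonZero p}} → (x * p) * 1/ p ≡ x
  *-1/-cancelʳ x p = begin
    (x * p) * 1/ p   ≡⟨ *-assoc x p (1/ p) ⟩
    x * (p * 1/ p)   ≡⟨ cong (x *_) (*-inverseʳ p) ⟩
    x * 1ℚ           ≡⟨ *-identityʳ x ⟩
    x                ∎
    where open ≡-Reasoning

  *-1/-cancelˡ : ∀ x p .{{_ : NonZero p}} → (x * 1/ p) * p ≡ x
  *-1/-cancelˡ x p = begin
    (x * 1/ p) * p   ≡⟨ *-assoc x (1/ p) p ⟩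
    x * (1/ p * p)   ≡⟨ cong (x *_) (*-inverseˡ p) ⟩
    x * 1ℚ           ≡⟨ *-identityʳ x ⟩
    x                ∎
    where open ≡-Reasoning

  x*p≡0⇒x≡0 : ∀ {x p} → p ≢ 0ℚ → x * p ≡ 0ℚ → x ≡ 0ℚ
  x*p≡0⇒x≡0 {x} {p} p≢0 xp≡0 = begin
    x                ≡⟨ sym (*-1/-cancelʳ x p) ⟩
    (x * p) * 1/ p   ≡⟨ cong (_* 1/ p) xp≡0 ⟩
    0ℚ * 1/ p        ≡⟨ *-zeroˡ (1/ p) ⟩
    0ℚ               ∎
    where
    open ≡-Reasoning
    instance
      p-nonZero : NonZero p
      p-nonZero = ≢-nonZero p≢0

  zeros-or-nonzero : ∀ {n} (v : Fin n → ℚ) → (∀ k → v k ≡ 0ℚ) ⊎ ∃ λ k → v k ≢ 0ℚ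
  zeros-or-nonzero v with Fin.any? (λ k → ¬? (v k ≟ 0ℚ))
  ... | yes nonzero  = inj₂ nonzero
  ... | no ¬nonzero = inj₁ λ k → decidable-stable (v k ≟ 0ℚ) (λ vₖ≢0 → ¬nonzero (k , vₖ≢0))

  all-punchIn : ∀ {n} {P : Fin (suc n) → Set} k₀ → P k₀ → (∀ i → P (punchIn k₀ i)) → ∀ k → P k
  all-punchIn {P = P} k₀ pk₀ p-punchIn k with k₀ Fin.≟ k
  ... | yes refl = pk₀
  ... | no k₀≢k  = subst P (Fin.punchIn-punchOut k₀≢k) (p-punchIn (Fin.punchOut k₀≢k))

  -- Row punchIn k₀ i is ratio i times row k₀ plus (0 ∷ reduced i); weight c is the resulting
  -- coefficient of row k₀ in the combination c of the rows of a.
  module Pivot {s L} (a : Fin (suc s) → Fin (suc L) → ℚ) (k₀ : Fin (suc s)) (pivot≢0 : a k₀ zero ≢ 0ℚ) where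
    open ≡-Reasoning

    private
      p : ℚ
      p = a k₀ zero
      instance
        p-nonZero : NonZero p
        p-nonZero = ≢-nonZero pivot≢0

    ratio : Fin s → ℚ
    ratio i = a (punchIn k₀ i) zero * 1/ p

    reduced : Fin s → Fin L → ℚ
    reduced i j = a (punchIn k₀ i) (suc j) - ratio i * a k₀ (suc j)

    weight : (Fin (suc s) → ℚ) → ℚ
    weight c = c k₀ + ∑[ i < s ] (removeAt c k₀ i * ratio i)

    lincomb-pivotColumn : ∀ c → lincomb c a zero ≡ weight c * p
    lincomb-pivotColumn c = begin
      lincomb c a zero
        ≡⟨ lincomb-removeAt c a k₀ zero ⟩
      c k₀ * p + ∑[ i < s ] (c′ i * a (punchIn k₀ i) zero)
        ≡⟨ cong (c k₀ * p +_) (sum-cong-≗ λ i → cong (c′ i *_) (sym (*-1/-cancelˡ _ p))) ⟩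
      c k₀ * p + ∑[ i < s ] (c′ i * (ratio i * p))
        ≡⟨ cong (c k₀ * p +_) (sum-cong-≗ λ i → sym (*-assoc (c′ i) (ratio i) p)) ⟩
      c k₀ * p + ∑[ i < s ] (c′ i * ratio i * p)
        ≡⟨ cong (c k₀ * p +_) (sym (*-distribʳ-sum p (λ i → c′ i * ratio i))) ⟩
      c k₀ * p + ∑[ i < s ] (c′ i * ratio i) * p
        ≡⟨ sym (*-distribʳ-+ p (c k₀) _) ⟩
      weight c * p ∎
      where c′ = removeAt c k₀

    lincomb-otherColumn : ∀ c j →
      lincomb c a (suc j) ≡ lincomb (removeAt c k₀) reduced j + weight c * a k₀ (suc j)
    lincomb-otherColumn c j = begin
      lincomb c a (suc j)
        ≡⟨ lincomb-removeAt c a k₀ (suc j) ⟩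
      c k₀ * B + ∑[ i < s ] (c′ i * a (punchIn k₀ i) (suc j))
        ≡⟨ cong (c k₀ * B +_) (sum-cong-≗ λ i → split (c′ i) _ (ratio i) B) ⟩
      c k₀ * B + ∑[ i < s ] (c′ i * reduced i j + c′ i * ratio i * B)
        ≡⟨ cong (c k₀ * B +_) (∑-distrib-+ (λ i → c′ i * reduced i j) _) ⟩
      c k₀ * B + (lincomb c′ reduced j + ∑[ i < s ] (c′ i * ratio i * B))
        ≡⟨ cong (λ y → c k₀ * B + (lincomb c′ reduced j + y))
                (sym (*-distribʳ-sum B (λ i → c′ i * ratio i))) ⟩
      c k₀ * B + (lincomb c′ reduced j + S * B)
        ≡⟨ regroup (c k₀) B (lincomb c′ reduced j) S ⟩
      lincomb c′ reduced j + weight c * B ∎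
      where
      B = a k₀ (suc j)
      c′ = removeAt c k₀
      S = ∑[ i < s ] (c′ i * ratio i)
      split : ∀ c x r B → c * x ≡ c * (x - r * B) + c * r * B
      split = solve-∀ ℚ-ring
      regroup : ∀ x B y S → x * B + (y + S * B) ≡ y + (x + S) * B
      regroup = solve-∀ ℚ-ring

    dependent : Dependent reduced → Dependent a
    dependent (c′ , c′·r≡0 , i , c′ᵢ≢0) =
      c , c·a≡0 , punchIn k₀ i , λ cᵢ≡0 → c′ᵢ≢0 (trans (sym (removeAt-c i)) cᵢ≡0)
      where
      S = ∑[ i < s ] (c′ i * ratio i)
      c = insertAt c′ k₀ (- S)
      removeAt-c : ∀ i → removeAt c k₀ i ≡ c′ i
      removeAt-c = insertAt-punchIn c′ k₀ (- S)
      weight≡0 : weight c ≡ 0ℚ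
      weight≡0 = begin
        c k₀ + ∑[ i < s ] (removeAt c k₀ i * ratio i)
          ≡⟨ cong₂ _+_ (insertAt-lookup c′ k₀ (- S)) (sum-cong-≗ λ i → cong (_* ratio i) (removeAt-c i)) ⟩
        - S + S
          ≡⟨ +-inverseˡ S ⟩
        0ℚ ∎
      c·a≡0 : ∀ q → lincomb c a q ≡ 0ℚ
      c·a≡0 zero    = trans (lincomb-pivotColumn c) (trans (cong (_* p) weight≡0) (*-zeroˡ p))
      c·a≡0 (suc j) = begin
        lincomb c a (suc j)                                    ≡⟨ lincomb-otherColumn c j ⟩
        lincomb (removeAt c k₀) reduced j + weight c * a k₀ (suc j)
          ≡⟨ cong₂ _+_ (trans (sum-cong-≗ λ i → cong (_* reduced i j) (removeAt-c i)) (c′·r≡0 j))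
                       (trans (cong (_* a k₀ (suc j)) weight≡0) (*-zeroˡ (a k₀ (suc j)))) ⟩
        0ℚ + 0ℚ                                                ≡⟨ +-identityʳ 0ℚ ⟩
        0ℚ                                                     ∎

    independent : Independent reduced → Independent a
    independent ind c c·a≡0 = all-punchIn k₀ cₖ₀≡0 c′≡0
      where
      c′ = removeAt c k₀
      weight≡0 : weight c ≡ 0ℚ
      weight≡0 = x*p≡0⇒x≡0 pivot≢0 (trans (sym (lincomb-pivotColumn c)) (c·a≡0 zero))
      weight≡0⇒ : ∀ x → weight c * x ≡ 0ℚ
      weight≡0⇒ x = trans (cong (_* x) weight≡0) (*-zeroˡ x)
      c′·r≡0 : ∀ j → lincomb c′ reduced j ≡ 0ℚ
      c′·r≡0 j = begin
        lincomb c′ reduced j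
          ≡⟨ sym (+-identityʳ _) ⟩
        lincomb c′ reduced j + 0ℚ
          ≡⟨ cong (lincomb c′ reduced j +_) (sym (weight≡0⇒ (a k₀ (suc j)))) ⟩
        lincomb c′ reduced j + weight c * a k₀ (suc j)
          ≡⟨ sym (lincomb-otherColumn c j) ⟩
        lincomb c a (suc j)
          ≡⟨ c·a≡0 (suc j) ⟩
        0ℚ ∎
      c′≡0 : ∀ i → c′ i ≡ 0ℚ
      c′≡0 = ind c′ c′·r≡0
      cₖ₀≡0 : c k₀ ≡ 0ℚ
      cₖ₀≡0 = begin
        c k₀
          ≡⟨ sym (+-identityʳ (c k₀)) ⟩
        c k₀ + 0ℚ
          ≡⟨ cong (c k₀ +_) (sym (sum-zero λ i → trans (cong (_* ratio i) (c′≡0 i)) (*-zeroˡ (ratio i)))) ⟩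
        weight c
          ≡⟨ weight≡0 ⟩
        0ℚ ∎

  dependent-or-independent : ∀ L (a : Fin s → Fin L → ℚ) → Dependent a ⊎ (Independent a × s ≤ L)
  dependent-or-independent {zero}  L       a = inj₂ ((λ _ _ ()) , z≤n)
  dependent-or-independent {suc s} zero    a = inj₁ ((λ _ → 1ℚ) , (λ ()) , zero , 1≢0)
  dependent-or-independent {suc s} (suc L) a with zeros-or-nonzero (λ k → a k zero)
  ... | inj₂ (k₀ , pivot≢0) =
    Sum.map dependent (Product.map independent s≤s) (dependent-or-independent L reduced)
    where open Pivot a k₀ pivot≢0
  ... | inj₁ column₀≡0 =
    Sum.map dependent (Product.map independent ℕ.m≤n⇒m≤1+n) (dependent-or-independent L (λ k j → a k (suc j)))
    where
    lincomb-column₀ : ∀ c → lincomb c a zero ≡ 0ℚ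
    lincomb-column₀ c = sum-zero λ k → trans (cong (c k *_) (column₀≡0 k)) (*-zeroʳ (c k))
    dependent : Dependent (λ k j → a k (suc j)) → Dependent a
    dependent (c , c·a≡0 , nonzero) = c , (λ { zero → lincomb-column₀ c ; (suc j) → c·a≡0 j }) , nonzero
    independent : Independent (λ k j → a k (suc j)) → Independent a
    independent ind c c·a≡0 = ind c (c·a≡0 ∘ suc)

  independent⇒≤ : (a : Fin s → Fin L → ℚ) → Independent a → s ≤ L
  independent⇒≤ {L = L} a ind with dependent-or-independent L a
  ... | inj₁ dep        = ⊥-elim (dependent⇒¬independent dep ind)
  ... | inj₂ (_ , s≤L) = s≤L

  ∈Span-cong : ∀ {v w : Q → ℚ} {g : Fin t → Q → ℚ} → (∀ q → v q ≡ w q) → v ∈Span g → w ∈Span g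
  ∈Span-cong v≗w (a , v≡a·g) = a , λ q → trans (sym (v≗w q)) (v≡a·g q)

  generator-∈Span : (g : Fin t → Q → ℚ) → ∀ k → g k ∈Span g
  generator-∈Span {t = suc t} g k = δ , λ q → sym (begin
    lincomb δ g q
      ≡⟨ lincomb-removeAt δ g k q ⟩
    δ k * g k q + lincomb (removeAt δ k) (removeAt g k) q
      ≡⟨ cong₂ _+_ (cong (_* g k q) (insertAt-lookup _ k 1ℚ)) (sum-zero (δ-punchIn q)) ⟩
    1ℚ * g k q + 0ℚ
      ≡⟨ +-identityʳ _ ⟩
    1ℚ * g k q
      ≡⟨ *-identityˡ _ ⟩
    g k q ∎)
    where
    open ≡-Reasoning
    δ = insertAt (λ _ → 0ℚ) k 1ℚ
    δ-punchIn : ∀ q i → removeAt δ k i * g (punchIn k i) q ≡ 0ℚ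
    δ-punchIn q i = trans (cong (_* g (punchIn k i) q) (insertAt-punchIn (λ _ → 0ℚ) k 1ℚ i))
                          (*-zeroˡ (g (punchIn k i) q))

  ∈Span-+ : ∀ {v w : Q → ℚ} {g : Fin t → Q → ℚ} → v ∈Span g → w ∈Span g → (λ q → v q + w q) ∈Span g
  ∈Span-+ {t = t} {v = v} {w} {g} (a , v≡a·g) (b , w≡b·g) = (λ j → a j + b j) , λ q → begin
    v q + w q                            ≡⟨ cong₂ _+_ (v≡a·g q) (w≡b·g q) ⟩
    lincomb a g q + lincomb b g q        ≡⟨ sym (∑-distrib-+ (λ j → a j * g j q) (λ j → b j * g j q)) ⟩
    ∑[ j < t ] (a j * g j q + b j * g j q) ≡⟨ sum-cong-≗ (λ j → sym (*-distribʳ-+ (g j q) (a j) (b j))) ⟩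
    lincomb (λ j → a j + b j) g q        ∎
    where open ≡-Reasoning

  ∈Span-* : ∀ {v : Q → ℚ} {g : Fin t → Q → ℚ} x → v ∈Span g → (λ q → x * v q) ∈Span g
  ∈Span-* {t = t} {v = v} {g} x (a , v≡a·g) = (λ j → x * a j) , λ q → begin
    x * v q                          ≡⟨ cong (x *_) (v≡a·g q) ⟩
    x * lincomb a g q                ≡⟨ *-distribˡ-sum x (λ j → a j * g j q) ⟩
    ∑[ j < t ] (x * (a j * g j q))   ≡⟨ sum-cong-≗ (λ j → sym (*-assoc x (a j) (g j q))) ⟩
    lincomb (λ j → x * a j) g q      ∎
    where open ≡-Reasoning

  ∈Span-- : ∀ {v w : Q → ℚ} {g : Fin t → Q → ℚ} → v ∈Span g → w ∈Span g → (λ q → v q - w q) ∈Span g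
  ∈Span-- {v = v} {w} v∈g w∈g = ∈Span-cong (λ q → sym (minus (v q) (w q))) (∈Span-+ v∈g (∈Span-* (- 1ℚ) w∈g))
    where
    minus : ∀ x y → x - y ≡ x + - 1ℚ * y
    minus = solve-∀ ℚ-ring

  ∈Span-trans : ∀ {u} {v : Q → ℚ} {g : Fin t → Q → ℚ} {h : Fin u → Q → ℚ} →
    v ∈Span g → (∀ j → g j ∈Span h) → v ∈Span h
  ∈Span-trans {t = t} {v = v} {g} {h} (a , v≡a·g) g∈h = (λ i → ∑[ j < t ] (a j * b j i)) , λ q → begin
    v q                                    ≡⟨ v≡a·g q ⟩
    lincomb a g q                          ≡⟨ sum-cong-≗ (λ j → cong (a j *_) (proj₂ (g∈h j) q)) ⟩
    lincomb a (λ j → lincomb (b j) h) q    ≡⟨ lincomb-lincomb a b h q ⟩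
    lincomb (λ i → ∑[ j < t ] (a j * b j i)) h q ∎
    where
    open ≡-Reasoning
    b = λ j → proj₁ (g∈h j)

  ∈Span-sub : ∀ {u} {v : Q → ℚ} {g : Fin u → Q → ℚ} (σ : Fin t → Fin u) → v ∈Span (g ∘ σ) → v ∈Span g
  ∈Span-sub {g = g} σ v∈gσ = ∈Span-trans v∈gσ (λ j → generator-∈Span g (σ j))

  independent-∈Span⇒≤ : {f : Fin s → Q → ℚ} {g : Fin t → Q → ℚ} →
    (∀ k → f k ∈Span g) → Independent f → s ≤ t
  independent-∈Span⇒≤ {f = f} {g} f∈g ind = independent⇒≤ a ind-a
    where
    a = λ k → proj₁ (f∈g k)
    ind-a : Independent a
    ind-a c c·a≡0 = ind c λ q → begin
      lincomb c f q
        ≡⟨ sum-cong-≗ (λ k → cong (c k *_) (proj₂ (f∈g k) q)) ⟩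
      lincomb c (λ k → lincomb (a k) g) q
        ≡⟨ lincomb-lincomb c a g q ⟩
      lincomb (λ j → lincomb c a j) g q
        ≡⟨ sum-zero (λ j → trans (cong (_* g j q) (c·a≡0 j)) (*-zeroˡ (g j q))) ⟩
      0ℚ ∎
      where open ≡-Reasoning

  head-∈Span-tail : {f : Fin (suc s) → Q → ℚ} → Independent (f ∘ suc) → Dependent f → f zero ∈Span (f ∘ suc)
  head-∈Span-tail {s = s} {f = f} ind (c , c·f≡0 , k , cₖ≢0) with c zero ≟ 0ℚ
  ... | yes c₀≡0 = ⊥-elim (cₖ≢0 (c≡0 k))
    where
    c≡0 : ∀ k → c k ≡ 0ℚ
    c≡0 zero    = c₀≡0
    c≡0 (suc j) = ind (c ∘ suc) (λ q → begin
      lincomb (c ∘ suc) (f ∘ suc) q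
        ≡⟨ sym (+-identityˡ _) ⟩
      0ℚ + lincomb (c ∘ suc) (f ∘ suc) q
        ≡⟨ cong (_+ lincomb (c ∘ suc) (f ∘ suc) q) (sym (trans (cong (_* f zero q) c₀≡0) (*-zeroˡ (f zero q)))) ⟩
      lincomb c f q
        ≡⟨ c·f≡0 q ⟩
      0ℚ ∎) j
      where open ≡-Reasoning
  ... | no c₀≢0 = (λ j → (- 1/ c zero) * c (suc j)) , λ q → sym (begin
    ∑[ j < s ] ((- 1/ c zero) * c (suc j) * f (suc j) q)
      ≡⟨ sum-cong-≗ (λ j → *-assoc (- 1/ c zero) (c (suc j)) (f (suc j) q)) ⟩
    ∑[ j < s ] ((- 1/ c zero) * (c (suc j) * f (suc j) q))
      ≡⟨ sym (*-distribˡ-sum (- 1/ c zero) (λ j → c (suc j) * f (suc j) q)) ⟩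
    (- 1/ c zero) * lincomb (c ∘ suc) (f ∘ suc) q
      ≡⟨ cong ((- 1/ c zero) *_) (tail≡ (c zero * f zero q) _ (c·f≡0 q)) ⟩
    (- 1/ c zero) * (- (c zero * f zero q))
      ≡⟨ neg-neg (1/ c zero) (c zero) (f zero q) ⟩
    (c zero * 1/ c zero) * f zero q
      ≡⟨ cong (_* f zero q) (*-inverseʳ (c zero)) ⟩
    1ℚ * f zero q
      ≡⟨ *-identityˡ (f zero q) ⟩
    f zero q ∎)
    where
    open ≡-Reasoning
    instance
      c₀-nonZero : NonZero (c zero)
      c₀-nonZero = ≢-nonZero c₀≢0
    tail≡ : ∀ x y → x + y ≡ 0ℚ → y ≡ - x
    tail≡ x y x+y≡0 = trans (shift x y) (trans (cong (_- x) x+y≡0) (+-identityˡ (- x)))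
      where
      shift : ∀ x y → y ≡ (x + y) - x
      shift = solve-∀ ℚ-ring
    neg-neg : ∀ i c x → (- i) * (- (c * x)) ≡ (c * i) * x
    neg-neg = solve-∀ ℚ-ring

  record Enumeration (A : Set) : Set where
    field
      size            : ℕ
      enum            : Fin size → A
      enum-surjective : ∀ x → ∃ λ j → enum j ≡ x

  module _ {Q : Set} (E : Enumeration Q) where
    open Enumeration E

    dependent-or-independent-on : (f : Fin s → Q → ℚ) → Dependent f ⊎ Independent f
    dependent-or-independent-on f with dependent-or-independent size (λ k j → f k (enum j))
    ... | inj₂ (ind , _)                   = inj₂ λ c c·f≡0 → ind c (c·f≡0 ∘ enum)
    ... | inj₁ (c , c·f≡0 , nonzero) = inj₁ (c , c·f≡0′ , nonzero)
      where
      c·f≡0′ : ∀ q → lincomb c f q ≡ 0ℚ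
      c·f≡0′ q with enum-surjective q
      ... | j , refl = c·f≡0 j

    independent-spanning-subfamily : ∀ {K} (R : Fin K → Q → ℚ) →
      Σ[ t ∈ ℕ ] Σ[ ρ ∈ (Fin t → Fin K) ] Independent (R ∘ ρ) × (∀ k → R k ∈Span (R ∘ ρ))
    independent-spanning-subfamily {zero}  R = zero , (λ ()) , (λ _ _ ()) , (λ ())
    independent-spanning-subfamily {suc K} R with independent-spanning-subfamily (R ∘ suc)
    ... | t , ρ , ind , spans with dependent-or-independent-on (R ∘ (zero ∷ suc ∘ ρ))
    ...   | inj₂ ind′ = suc t , zero ∷ suc ∘ ρ , ind′ , λ
      { zero    → generator-∈Span (R ∘ (zero ∷ suc ∘ ρ)) zero
      ; (suc k) → ∈Span-sub {g = R ∘ (zero ∷ suc ∘ ρ)} suc (spans k)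
      }
    ...   | inj₁ dep  = t , suc ∘ ρ , ind , λ
      { zero    → head-∈Span-tail {f = R ∘ (zero ∷ suc ∘ ρ)} ind dep
      ; (suc k) → spans k
      }

  independent-suc : {f : Fin (suc t) → Q → ℚ} → Independent f → Independent (f ∘ suc)
  independent-suc {f = f} ind c c·f≡0 j = ind (0ℚ ∷ c) (λ q → begin
    0ℚ * f zero q + lincomb c (f ∘ suc) q  ≡⟨ cong (_+ lincomb c (f ∘ suc) q) (*-zeroˡ (f zero q)) ⟩
    0ℚ + lincomb c (f ∘ suc) q             ≡⟨ +-identityˡ _ ⟩
    lincomb c (f ∘ suc) q                  ≡⟨ c·f≡0 q ⟩
    0ℚ                                     ∎) (suc j)
    where open ≡-Reasoning

  independent-subfamily : s ≤ t → (f : Fin t → Q → ℚ) → Independent f →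
    Σ[ σ ∈ (Fin s → Fin t) ] Independent (f ∘ σ)
  independent-subfamily s≤t = go (ℕ.≤⇒≤′ s≤t)
    where
    go : ∀ {s t} → s ℕ.≤′ t → (f : Fin t → Q → ℚ) → Independent f →
         Σ[ σ ∈ (Fin s → Fin t) ] Independent (f ∘ σ)
    go ℕ.≤′-refl        f ind = (λ k → k) , ind
    go (ℕ.≤′-step s≤′t) f ind with go s≤′t (f ∘ suc) (independent-suc {f = f} ind)
    ... | σ , ind′ = suc ∘ σ , ind′

  row : {P : Set} → (P → P → ℕ) → P → P → ℚ
  row M p q = toℚ (M p q)

  module _ {P : Set} (M : P → P → ℕ) {r} (rows : Fin r → P) where

    independent⇒LinIndepRows : Independent (row M ∘ rows) → LinIndepRows M rows
    independent⇒LinIndepRows ind c h = ind c λ q → trans (sym (sumF≡sum (λ k → c k * row M (rows k) q))) (h q)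

    LinIndepRows⇒independent : LinIndepRows M rows → Independent (row M ∘ rows)
    LinIndepRows⇒independent ind c h = ind c λ q → trans (sumF≡sum (λ k → c k * row M (rows k) q)) (h q)

  module _ {P : Set} (E : Enumeration P) (M : P → P → ℕ) where
    open Enumeration E

    row-basis : Σ[ t ∈ ℕ ] Σ[ ρ ∈ (Fin t → Fin size) ]
      Independent (row M ∘ enum ∘ ρ) × (∀ p → row M p ∈Span (row M ∘ enum ∘ ρ))
    row-basis with independent-spanning-subfamily E (row M ∘ enum)
    ... | t , ρ , ind , spans = t , ρ , ind , row-∈Span
      where
      row-∈Span : ∀ p → row M p ∈Span (row M ∘ enum ∘ ρ)
      row-∈Span p with enum-surjective p
      ... | j , refl = spans j

    rank-exists : ∃ (HasRank M)
    rank-exists with row-basis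
    ... | t , ρ , ind , spans = t , (enum ∘ ρ , independent⇒LinIndepRows M (enum ∘ ρ) ind) , λ rows ind′ →
      ℕ.<-irrefl refl (independent-∈Span⇒≤ (spans ∘ rows) (LinIndepRows⇒independent M rows ind′))

    independent-rows : {f : Fin s → P → ℚ} → (∀ k → f k ∈Span (row M ∘ enum)) → Independent f →
      Σ[ rows ∈ (Fin s → P) ] Independent (row M ∘ rows)
    independent-rows f∈rows ind with row-basis
    ... | t , ρ , ind-basis , spans =
      let σ , ind-σ = independent-subfamily s≤t (row M ∘ enum ∘ ρ) ind-basis in enum ∘ ρ ∘ σ , ind-σ
      where
      s≤t = independent-∈Span⇒≤ (λ k → ∈Span-trans (f∈rows k) (spans ∘ enum)) ind

  module _ {P P′ : Set} (E′ : Enumeration P′) (M : P → P → ℕ) (N : P′ → P′ → ℕ) (ι : P′ → P)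
           (N≡M∘ι : ∀ p q → N p q ≡ M (ι p) (ι q)) (M-sym : ∀ p q → M p q ≡ M q p)
           (row-∈Span : ∀ p → row M p ∈Span (row M ∘ ι ∘ Enumeration.enum E′)) where
    open Enumeration E′

    private
      lincomb-N≡M : ∀ {s} (c : Fin s → ℚ) (rows : Fin s → P′) q →
        lincomb c (row N ∘ rows) q ≡ lincomb c (row M ∘ ι ∘ rows) (ι q)
      lincomb-N≡M c rows q = sum-cong-≗ λ k → cong (λ x → c k * toℚ x) (N≡M∘ι (rows k) q)

    HasRank-principalSubmatrix : ∀ {r} → HasRank M r → HasRank N r
    HasRank-principalSubmatrix {r} ((ρ , indM) , noM) = rowsN , noN
      where
      open ≡-Reasoning
      coeff : P → Fin size → ℚ
      coeff q = proj₁ (row-∈Span q)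

      -- M is symmetric, so its columns are spanned by the columns through ι as well.
      column-∈Span : ∀ q p → row M p q ≡ ∑[ i < size ] (coeff q i * row M p (ι (enum i)))
      column-∈Span q p = begin
        toℚ (M p q)
          ≡⟨ cong toℚ (M-sym p q) ⟩
        toℚ (M q p)
          ≡⟨ proj₂ (row-∈Span q) p ⟩
        ∑[ i < size ] (coeff q i * toℚ (M (ι (enum i)) p))
          ≡⟨ sum-cong-≗ (λ i → cong (λ x → coeff q i * toℚ x) (M-sym _ p)) ⟩
        ∑[ i < size ] (coeff q i * toℚ (M p (ι (enum i)))) ∎

      restricted : Fin r → P′ → ℚ
      restricted k q′ = row M (ρ k) (ι q′)

      restricted-∈Span : ∀ k → restricted k ∈Span (row N ∘ enum)
      restricted-∈Span k =
        coeff (ρ k) , λ q′ → trans (proj₂ (row-∈Span (ρ k)) (ι q′)) (sym (lincomb-N≡M (coeff (ρ k)) enum q′))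

      restricted-independent : Independent restricted
      restricted-independent c c·r≡0 = LinIndepRows⇒independent M ρ indM c λ q → begin
        ∑[ k < r ] (c k * row M (ρ k) q)
          ≡⟨ sum-cong-≗ (λ k → cong (c k *_) (column-∈Span q (ρ k))) ⟩
        ∑[ k < r ] (c k * ∑[ i < size ] (coeff q i * restricted k (enum i)))
          ≡⟨ ∑-∑-*ˡ c (λ k i → coeff q i * restricted k (enum i)) ⟩
        ∑[ i < size ] ∑[ k < r ] (c k * (coeff q i * restricted k (enum i)))
          ≡⟨ sum-cong-≗ (λ i → sum-cong-≗ (λ k → swap (c k) (coeff q i) (restricted k (enum i)))) ⟩
        ∑[ i < size ] ∑[ k < r ] (coeff q i * (c k * restricted k (enum i)))
          ≡⟨ sum-cong-≗ (λ i → sym (*-distribˡ-sum (coeff q i) (λ k → c k * restricted k (enum i)))) ⟩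
        ∑[ i < size ] (coeff q i * lincomb c restricted (enum i))
          ≡⟨ sum-zero (λ i → trans (cong (coeff q i *_) (c·r≡0 (enum i))) (*-zeroʳ (coeff q i))) ⟩
        0ℚ ∎
        where
        swap : ∀ x y z → x * (y * z) ≡ y * (x * z)
        swap = solve-∀ ℚ-ring

      rowsN : Σ[ rows ∈ (Fin r → P′) ] LinIndepRows N rows
      rowsN = let rows , ind = independent-rows E′ N restricted-∈Span restricted-independent
              in  rows , independent⇒LinIndepRows N rows ind

      noN : ∀ rows → ¬ LinIndepRows N rows
      noN rows indN = noM (ι ∘ rows) (independent⇒LinIndepRows M (ι ∘ rows) λ c c·M≡0 →
        LinIndepRows⇒independent N rows indN c λ q′ → trans (lincomb-N≡M c rows q′) (c·M≡0 (ι q′)))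

  toℚ≡mkℚ : ∀ k → toℚ k ≡ mkℚ (ℤ.+ k) 0 (coprime-sym (1-coprimeTo k))
  toℚ≡mkℚ k = normalize-coprime (coprime-sym (1-coprimeTo k))

  toℚ-+ : ∀ a b → toℚ (a ℕ.+ b) ≡ toℚ a + toℚ b
  toℚ-+ a b = trans (cong (_/ 1) pos-+) (cong₂ _+_ (sym (toℚ≡mkℚ a)) (sym (toℚ≡mkℚ b)))
    where
    pos-+ : ℤ.+ (a ℕ.+ b) ≡ ℤ.+ a ℤ.* ℤ.+ 1 ℤ.+ ℤ.+ b ℤ.* ℤ.+ 1
    pos-+ = sym (cong₂ ℤ._+_ (ℤ.*-identityʳ (ℤ.+ a)) (ℤ.*-identityʳ (ℤ.+ b)))

  toℚ-cancel : ∀ a b c d → a ℕ.+ d ≡ b ℕ.+ c → toℚ a ≡ toℚ b + toℚ c - toℚ d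
  toℚ-cancel a b c d a+d≡b+c = begin
    toℚ a                          ≡⟨ cancel (toℚ a) (toℚ d) ⟩
    (toℚ a + toℚ d) - toℚ d        ≡⟨ cong (_- toℚ d) (sym (toℚ-+ a d)) ⟩
    toℚ (a ℕ.+ d) - toℚ d          ≡⟨ cong (λ t → toℚ t - toℚ d) a+d≡b+c ⟩
    toℚ (b ℕ.+ c) - toℚ d          ≡⟨ cong (_- toℚ d) (toℚ-+ b c) ⟩
    toℚ b + toℚ c - toℚ d          ∎
    where
    open ≡-Reasoning
    cancel : ∀ x y → x ≡ (x + y) - y
    cancel = solve-∀ ℚ-ring

module GraphDistance where
  open import Data.Nat as ℕ using (ℕ; zero; suc; _+_; _≤_; _<_; z≤n; s≤s)
  import Data.Nat.Properties as ℕ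
  open import Data.Fin as Fin using (Fin; zero; suc; punchIn)
  import Data.Fin.Properties as Fin
  open import Data.Fin.Subset using (Subset; _∈_; _⊆_; _⊂_; ⁅_⁆; ⊤; ∣_∣)
  open import Data.Fin.Subset.Properties
    using (_∈?_; _⊂?_; ∈⊤; x∈⁅y⁆⇒x≡y; ∣⁅x⁆∣≡1; ∣p∣≤n; ∣p∣≡n⇒p≡⊤; p⊆q⇒∣p∣≤∣q∣; p⊂q⇒∣p∣<∣q∣)
  open import Data.Vec using (tabulate)
  open import Data.Vec.Properties using (lookup∘tabulate; []=⇒lookup; lookup⇒[]=)
  open import Data.Bool using (Bool; true; false; _∨_; _∧_)
  open import Data.Product using (∃; Σ-syntax; _×_; _,_; proj₁; proj₂)
  open import Data.Sum using (_⊎_; inj₁; inj₂)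
  open import Data.Empty using (⊥-elim)
  open import Function using (_∘_)
  open import Relation.Nullary using (¬_; yes; no)
  open import Relation.Binary.PropositionalEquality

  ∨-trueˡ : ∀ {a} b → a ≡ true → a ∨ b ≡ true
  ∨-trueˡ b refl = refl

  ∨-trueʳ : ∀ a {b} → b ≡ true → a ∨ b ≡ true
  ∨-trueʳ true  _ = refl
  ∨-trueʳ false b = b

  ∨-true⁻ : ∀ a {b} → a ∨ b ≡ true → a ≡ true ⊎ b ≡ true
  ∨-true⁻ true  _ = inj₁ refl
  ∨-true⁻ false b = inj₂ b

  ∧-true : ∀ {a b} → a ≡ true → b ≡ true → a ∧ b ≡ true
  ∧-true refl refl = refl

  ∧-true⁻ : ∀ a {b} → a ∧ b ≡ true → a ≡ true × b ≡ true
  ∧-true⁻ true refl = refl , refl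

  anyF-intro : ∀ {n} (p : Fin n → Bool) z → p z ≡ true → anyF p ≡ true
  anyF-intro p zero    pz = ∨-trueˡ _ pz
  anyF-intro p (suc z) pz = ∨-trueʳ (p zero) (anyF-intro (p ∘ suc) z pz)

  anyF-elim : ∀ {n} (p : Fin n → Bool) → anyF p ≡ true → ∃ λ z → p z ≡ true
  anyF-elim {suc n} p any with ∨-true⁻ (p zero) any
  ... | inj₁ p₀ = zero , p₀
  ... | inj₂ anyₛ with anyF-elim (p ∘ suc) anyₛ
  ...   | z , pz = suc z , pz

  module _ {n} (G : Graph n) where

    Reach : ℕ → Fin n → Fin n → Set
    Reach k x y = reach G k x y ≡ true

    reach-refl : ∀ x → Reach 0 x x
    reach-refl x with x Fin.≟ x
    ... | yes _  = refl
    ... | no x≢x = ⊥-elim (x≢x refl)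

    reach-0⇒≡ : ∀ {x y} → Reach 0 x y → x ≡ y
    reach-0⇒≡ {x} {y} r with x Fin.≟ y
    ... | yes x≡y = x≡y

    reach-suc : ∀ k {x y} → Reach k x y → Reach (suc k) x y
    reach-suc k = ∨-trueˡ _

    reach-mono : ∀ {k k′ x y} → k ≤ k′ → Reach k x y → Reach k′ x y
    reach-mono k≤k′ = go (ℕ.≤⇒≤′ k≤k′)
      where
      go : ∀ {k k′ x y} → k ℕ.≤′ k′ → Reach k x y → Reach k′ x y
      go ℕ.≤′-refl                  r = r
      go (ℕ.≤′-step {k′} k≤′k′) r = reach-suc k′ (go k≤′k′ r)

    reach-snoc : ∀ k {x z y} → Reach k x z → adj G z y ≡ true → Reach (suc k) x y
    reach-snoc k {x} {z} {y} r e =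
      ∨-trueʳ (reach G k x y) (anyF-intro (λ z → reach G k x z ∧ adj G z y) z (∧-true r e))

    reach-unsnoc : ∀ k {x y} → Reach (suc k) x y → Reach k x y ⊎ ∃ λ z → Reach k x z × adj G z y ≡ true
    reach-unsnoc k {x} {y} r with ∨-true⁻ (reach G k x y) r
    ... | inj₁ r′ = inj₁ r′
    ... | inj₂ step with anyF-elim (λ z → reach G k x z ∧ adj G z y) step
    ...   | z , rz = inj₂ (z , ∧-true⁻ _ rz)

    reach-trans : ∀ a b {x y z} → Reach a x y → Reach b y z → Reach (b + a) x z
    reach-trans a zero    r₁ r₂ with reach-0⇒≡ r₂
    ... | refl = r₁
    reach-trans a (suc b) r₁ r₂ with reach-unsnoc b r₂
    ... | inj₁ r₂′            = reach-suc (b + a) (reach-trans a b r₁ r₂′)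
    ... | inj₂ (w , r₂′ , e) = reach-snoc (b + a) (reach-trans a b r₁ r₂′) e

    reach-adj : ∀ {x y} → adj G x y ≡ true → Reach 1 x y
    reach-adj {x} = reach-snoc 0 (reach-refl x)

    reach-sym : ∀ k {x y} → Reach k x y → Reach k y x
    reach-sym zero r with reach-0⇒≡ r
    ... | refl = r
    reach-sym (suc k) {x} {y} r with reach-unsnoc k r
    ... | inj₁ r′            = reach-suc k (reach-sym k r′)
    ... | inj₂ (z , r′ , e) = subst (λ j → Reach j y x) (ℕ.+-comm k 1)
                                (reach-trans 1 k (reach-adj (trans (Graph.sym G y z) e)) (reach-sym k r′))

    reach-uncons : ∀ k {x y} → Reach (suc k) x y → Reach k x y ⊎ ∃ λ z → adj G x z ≡ true × Reach k z y
    reach-uncons k {x} r with reach-unsnoc k (reach-sym (suc k) r)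
    ... | inj₁ r′            = inj₁ (reach-sym k r′)
    ... | inj₂ (z , r′ , e) = inj₂ (z , trans (Graph.sym G x z) e , reach-sym k r′)

  -- The balls around x grow strictly until they stabilise, so the ball of radius m already contains
  -- every vertex reachable from x; hence dist only has to try the radii 0, …, m.
  module Ball {m} (G : Graph (suc m)) (x : Fin (suc m)) where

    -- Opaque, so that the radius k can be inferred from ball k.
    opaque
      ball : ℕ → Subset (suc m)
      ball k = tabulate (reach G k x)

    opaque
      unfolding ball

      ∈ball⁺ : ∀ {k y} → Reach G k x y → y ∈ ball k
      ∈ball⁺ {k} {y} r = lookup⇒[]= y (ball k) (trans (lookup∘tabulate (reach G k x) y) r)

      ∈ball⁻ : ∀ {k y} → y ∈ ball k → Reach G k x y
      ∈ball⁻ {k} {y} y∈ = trans (sym (lookup∘tabulate (reach G k x) y)) ([]=⇒lookup y∈)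

    ball-⊆-suc : ∀ k → ball k ⊆ ball (suc k)
    ball-⊆-suc k = ∈ball⁺ ∘ reach-suc G k ∘ ∈ball⁻

    ball-stable : ∀ i → ball (suc i) ⊆ ball i → ∀ d → ball (d + i) ⊆ ball i
    ball-stable i stable zero    y∈ = y∈
    ball-stable i stable (suc d) y∈ with reach-unsnoc G (d + i) (∈ball⁻ y∈)
    ... | inj₁ r            = ball-stable i stable d (∈ball⁺ r)
    ... | inj₂ (z , r , e) = stable (∈ball⁺ (reach-snoc G i (∈ball⁻ (ball-stable i stable d (∈ball⁺ r))) e))

    ball-stabilises-or-grows : ∀ j → (Σ[ i ∈ ℕ ] i ≤ j × ball (suc i) ⊆ ball i) ⊎ suc j ≤ ∣ ball j ∣
    ball-stabilises-or-grows zero = inj₂ (subst (_≤ ∣ ball 0 ∣) (∣⁅x⁆∣≡1 x) (p⊆q⇒∣p∣≤∣q∣ ⁅x⁆⊆ball₀))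
      where
      ⁅x⁆⊆ball₀ : ⁅ x ⁆ ⊆ ball 0
      ⁅x⁆⊆ball₀ {y} y∈⁅x⁆ rewrite x∈⁅y⁆⇒x≡y x y∈⁅x⁆ = ∈ball⁺ (reach-refl G x)
    ball-stabilises-or-grows (suc j) with ball-stabilises-or-grows j
    ... | inj₁ (i , i≤j , stable) = inj₁ (i , ℕ.m≤n⇒m≤1+n i≤j , stable)
    ... | inj₂ big with ball j ⊂? ball (suc j)
    ...   | yes ball⊂ = inj₂ (ℕ.≤-trans (s≤s big) (p⊂q⇒∣p∣<∣q∣ ball⊂))
    ...   | no ¬ball⊂ = inj₁ (j , ℕ.n≤1+n j , stable)
      where
      stable : ball (suc j) ⊆ ball j
      stable {y} y∈ with y ∈? ball j
      ... | yes y∈′ = y∈′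
      ... | no y∉   = ⊥-elim (¬ball⊂ (ball-⊆-suc j , y , y∈ , y∉))

    reach-within : ∀ k {y} → Reach G k x y → Reach G m x y
    reach-within k {y} r with ball-stabilises-or-grows m
    ... | inj₁ (i , i≤m , stable) =
      reach-mono G i≤m (∈ball⁻ (ball-stable i stable k (∈ball⁺ (reach-mono G (ℕ.m≤m+n k i) r))))
    ... | inj₂ full = ∈ball⁻ (subst (y ∈_) (sym (∣p∣≡n⇒p≡⊤ (ℕ.≤-antisym (∣p∣≤n (ball m)) full))) ∈⊤)

  leastFrom-≤ : ∀ s f (p : ℕ → Bool) k → s ≤ k → p k ≡ true → leastFrom s f p ≤ k
  leastFrom-≤ s zero    p k s≤k pk = s≤k
  leastFrom-≤ s (suc f) p k s≤k pk with p s in ps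
  ... | true  = s≤k
  ... | false = leastFrom-≤ (suc s) f p k (ℕ.≤∧≢⇒< s≤k s≢k) pk
    where
    s≢k : s ≢ k
    s≢k refl with trans (sym ps) pk
    ... | ()

  leastFrom-hit : ∀ s f (p : ℕ → Bool) k → s ≤ k → k < s + f → p k ≡ true → p (leastFrom s f p) ≡ true
  leastFrom-hit s zero    p k s≤k k<s+0 pk = ⊥-elim (ℕ.<⇒≱ (subst (k <_) (ℕ.+-identityʳ s) k<s+0) s≤k)
  leastFrom-hit s (suc f) p k s≤k k<s+f pk with p s in ps
  ... | true  = ps
  ... | false = leastFrom-hit (suc s) f p k (ℕ.≤∧≢⇒< s≤k s≢k) (subst (k <_) (ℕ.+-suc s f) k<s+f) pk
    where
    s≢k : s ≢ k
    s≢k refl with trans (sym ps) pk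
    ... | ()

  module _ {n} (G : Graph n) where

    dist-≤ : ∀ k {x y} → Reach G k x y → dist G x y ≤ k
    dist-≤ k {x} {y} = leastFrom-≤ 0 n (λ k → reach G k x y) k z≤n

  module _ {m} (G : Graph (suc m)) where

    dist-reach : ∀ k {x y} → Reach G k x y → Reach G (dist G x y) x y
    dist-reach k {x} {y} r =
      leastFrom-hit 0 (suc m) (λ k → reach G k x y) m z≤n (ℕ.n<1+n m) (Ball.reach-within G x k r)

  module Distance {m} (G : Graph (suc m)) (connected : Connected G) where

    reach-dist : ∀ x y → Reach G (dist G x y) x y
    reach-dist x y = dist-reach G (proj₁ (connected x y)) (proj₂ (connected x y))

    dist-sym : ∀ x y → dist G x y ≡ dist G y x
    dist-sym x y = ℕ.≤-antisym (dist-≤ G (dist G y x) (reach-sym G (dist G y x) (reach-dist y x)))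
                               (dist-≤ G (dist G x y) (reach-sym G (dist G x y) (reach-dist x y)))

    dist-refl : ∀ x → dist G x x ≡ 0
    dist-refl x = ℕ.n≤0⇒n≡0 (dist-≤ G 0 (reach-refl G x))

    dist-triangle : ∀ x y z → dist G x z ≤ dist G x y + dist G y z
    dist-triangle x y z = subst (dist G x z ≤_) (ℕ.+-comm (dist G y z) (dist G x y))
      (dist-≤ G (dist G y z + dist G x y)
        (reach-trans G (dist G x y) (dist G y z) (reach-dist x y) (reach-dist y z)))

  module _ {n} (G : Graph n) {v w} (leaf : LeafAt G v w) where

    neighbour≢leaf : w ≢ v
    neighbour≢leaf refl with trans (sym (proj₁ leaf)) (Graph.irrefl G w)
    ... | ()

    reach-from-leaf : ∀ k {y} → y ≢ v → Reach G k v y → ∃ λ k′ → k ≡ suc k′ × Reach G k′ w y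
    reach-from-leaf zero    y≢v r = ⊥-elim (y≢v (sym (reach-0⇒≡ G r)))
    reach-from-leaf (suc k) y≢v r with reach-uncons G k r
    ... | inj₁ r′ with reach-from-leaf k y≢v r′
    ...   | k′ , refl , r″ = k , refl , reach-suc G k′ r″
    reach-from-leaf (suc k) y≢v r | inj₂ (z , e , r′) with proj₂ leaf z e
    ... | refl = k , refl , r′

  module _ {m} (G : Graph (suc m)) (connected : Connected G) {v w} (leaf : LeafAt G v w) where
    open Distance G connected

    dist-leaf : ∀ y → y ≢ v → dist G v y ≡ suc (dist G w y)
    dist-leaf y y≢v = ℕ.≤-antisym via-neighbour first-step
      where
      via-neighbour : dist G v y ≤ suc (dist G w y)
      via-neighbour = dist-≤ G (suc (dist G w y)) (subst (λ k → Reach G k v y) (ℕ.+-comm (dist G w y) 1)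
                        (reach-trans G 1 (dist G w y) (reach-adj G (proj₁ leaf)) (reach-dist w y)))
      first-step : suc (dist G w y) ≤ dist G v y
      first-step with reach-from-leaf G leaf (dist G v y) y≢v (reach-dist v y)
      ... | k′ , d≡1+k′ , r = subst (suc (dist G w y) ≤_) (sym d≡1+k′) (s≤s (dist-≤ G k′ r))

  reach-delete⁻ : ∀ {m} (G : Graph (suc m)) u k {i j} →
    Reach (delete G u) k i j → Reach G k (punchIn u i) (punchIn u j)
  reach-delete⁻ G u zero    {i} r with reach-0⇒≡ (delete G u) r
  ... | refl = reach-refl G (punchIn u i)
  reach-delete⁻ G u (suc k)     r with reach-unsnoc (delete G u) k r
  ... | inj₁ r′            = reach-suc G k (reach-delete⁻ G u k r′)
  ... | inj₂ (z , r′ , e) = reach-snoc G k (reach-delete⁻ G u k r′) e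

  module _ {m} (G : Graph (suc m)) {u w} (leaf : LeafAt G u w) where

    -- A walk that visits the leaf u enters and leaves it through w, so u can be cut out.
    reach-delete⁺ : ∀ k {i j} → Reach G k (punchIn u i) (punchIn u j) → Reach (delete G u) k i j
    reach-delete⁺ zero {i} {j} r with Fin.punchIn-injective u i j (reach-0⇒≡ G r)
    ... | refl = reach-refl (delete G u) i
    reach-delete⁺ (suc k) {i} {j} r with reach-unsnoc G k r
    ... | inj₁ r′ = reach-suc (delete G u) k (reach-delete⁺ k r′)
    ... | inj₂ (z , r′ , e) with u Fin.≟ z
    ...   | no u≢z = reach-snoc (delete G u) k
                       (reach-delete⁺ k (subst (Reach G k (punchIn u i)) (sym (Fin.punchIn-punchOut u≢z)) r′))
                       (subst (λ t → adj G t (punchIn u j) ≡ true) (sym (Fin.punchIn-punchOut u≢z)) e)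
    ...   | yes refl with reach-from-leaf G leaf k (Fin.punchInᵢ≢i u i) (reach-sym G k r′)
    ...     | k′ , refl , r″ = reach-suc (delete G u) k (reach-delete⁺ k (reach-suc G k′
                                 (subst (Reach G k′ (punchIn u i)) (sym (proj₂ leaf (punchIn u j) e)) (reach-sym G k′ r″))))

  module _ {m} (G : Graph (suc (suc m))) (connected : Connected G) {u w} (leaf : LeafAt G u w) where

    delete-connected : Connected (delete G u)
    delete-connected i j with connected (punchIn u i) (punchIn u j)
    ... | k , r = k , reach-delete⁺ G leaf k r

    dist-delete : ∀ i j → dist (delete G u) i j ≡ dist G (punchIn u i) (punchIn u j)
    dist-delete i j = ℕ.≤-antisym
      (dist-≤ (delete G u) dᴳ (reach-delete⁺ G leaf dᴳ (Distance.reach-dist G connected (punchIn u i) (punchIn u j))))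
      (dist-≤ G dᴴ (reach-delete⁻ G u dᴴ (Distance.reach-dist (delete G u) delete-connected i j)))
      where
      dᴳ = dist G (punchIn u i) (punchIn u j)
      dᴴ = dist (delete G u) i j

module FourPoint where
  open import Data.Nat as ℕ using (ℕ; suc; _+_; _≤_; _⊔_; s≤s)
  import Data.Nat.Properties as ℕ
  open import Relation.Binary using (DecidableEquality)
  open import Relation.Nullary using (yes; no)
  open import Data.Empty using (⊥-elim)
  open import Function using (_∘_)
  open import Relation.Binary.PropositionalEquality

  max3-swap₂₃ : ∀ a b c → max3 a b c ≡ max3 a c b
  max3-swap₂₃ a b c = trans (ℕ.⊔-assoc a b c) (trans (cong (a ⊔_) (ℕ.⊔-comm b c)) (sym (ℕ.⊔-assoc a c b)))

  max3-a-b-a : ∀ a b → b ≤ a → max3 a b a ≡ a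
  max3-a-b-a a b b≤a = trans (cong (_⊔ a) (ℕ.m≥n⇒m⊔n≡m b≤a)) (ℕ.⊔-idem a)

  pendant-arith : ∀ a b t → t ≤ a + b →
    max3 (suc (a + suc b)) t (suc (b + suc a)) ≡ suc (max3 (a + suc b) (suc t) (b + suc a))
  pendant-arith a b t t≤a+b rewrite ℕ.+-suc b a | ℕ.+-comm b a | ℕ.+-suc a b =
    trans (max3-a-b-a (suc (suc (a + b))) t (ℕ.m≤n⇒m≤1+n (ℕ.m≤n⇒m≤1+n t≤a+b)))
          (cong suc (sym (max3-a-b-a (suc (a + b)) (suc t) (s≤s t≤a+b))))

  module Max4PCProperties {A : Set} (_≟_ : DecidableEquality A) (d : A → A → ℕ)
           (d-refl : ∀ x → d x x ≡ 0) (d-sym : ∀ x y → d x y ≡ d y x)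
           (d-triangle : ∀ x y z → d x z ≤ d x y + d y z) where

    max4PC : A → A → A → A → ℕ
    max4PC w x y z = max3 (d w x + d y z) (d w y + d x z) (d w z + d x y)

    max4PC-swap : ∀ w x y z → max4PC x w y z ≡ max4PC w x y z
    max4PC-swap w x y z rewrite d-sym x w | ℕ.+-comm (d x y) (d w z) | ℕ.+-comm (d x z) (d w y) =
      max3-swap₂₃ (d w x + d y z) (d w z + d x y) (d w y + d x z)

    max4PC-comm : ∀ w x y z → max4PC w x y z ≡ max4PC y z w x
    max4PC-comm w x y z rewrite d-sym y w | d-sym z x | d-sym y x | d-sym z w
                               | ℕ.+-comm (d w x) (d y z) | ℕ.+-comm (d w z) (d x y) = refl

    max4PC-swapʳ : ∀ w x y z → max4PC w x y z ≡ max4PC w x z y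
    max4PC-swapʳ w x y z rewrite d-sym z y = max3-swap₂₃ (d w x + d y z) (d w y + d x z) (d w z + d x y)

    module Pendant {v w} (w≢v : w ≢ v) (d-pendant : ∀ y → y ≢ v → d v y ≡ suc (d w y)) where

      d-w-v : d w v ≡ 1
      d-w-v = trans (d-sym w v) (trans (d-pendant w w≢v) (cong suc (d-refl w)))

      max4PC-pendant-at : ∀ x z → x ≢ v → z ≢ v → max4PC v x v z ≡ suc (max4PC w x v z)
      max4PC-pendant-at x z x≢v z≢v
        rewrite d-refl v | d-sym x v | d-pendant x x≢v | d-pendant z z≢v | d-w-v =
        pendant-arith (d w x) (d w z) (d x z) (subst (λ t → d x z ≤ t + d w z) (d-sym x w) (d-triangle x w z))

      max4PC-pendant : ∀ x y z → x ≢ v → y ≢ z → max4PC v x y z ≡ suc (max4PC w x y z)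
      max4PC-pendant x y z x≢v y≢z with y ≟ v | z ≟ v
      ... | yes refl | yes refl = ⊥-elim (y≢z refl)
      ... | no y≢v   | no z≢v   rewrite d-pendant x x≢v | d-pendant y y≢v | d-pendant z z≢v = refl
      ... | yes refl | no z≢v   = max4PC-pendant-at x z x≢v z≢v
      ... | no y≢v   | yes refl = begin
        max4PC v x y v         ≡⟨ max4PC-swapʳ v x y v ⟩
        max4PC v x v y         ≡⟨ max4PC-pendant-at x y x≢v y≢v ⟩
        suc (max4PC w x v y)   ≡⟨ cong suc (max4PC-swapʳ w x v y) ⟩
        suc (max4PC w x y v)   ∎
        where open ≡-Reasoning

    module Twins {u v w} (u≢v : u ≢ v) (w≢u : w ≢ u) (w≢v : w ≢ v)
                 (u-pendant : ∀ y → y ≢ u → d u y ≡ suc (d w y))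
                 (v-pendant : ∀ y → y ≢ v → d v y ≡ suc (d w y)) where
      private
        module U = Pendant w≢u u-pendant
        module V = Pendant w≢v v-pendant

      max4PC-twins : ∀ x y z → x ≢ u → x ≢ v → y ≢ z → max4PC u x y z ≡ max4PC v x y z
      max4PC-twins x y z x≢u x≢v y≢z =
        trans (U.max4PC-pendant x y z x≢u y≢z) (sym (V.max4PC-pendant x y z x≢v y≢z))

      max4PC-twins-relation : ∀ x y z → x ≢ v → y ≢ z →
        max4PC u v y z + max4PC w x y z ≡ max4PC v w y z + max4PC v x y z
      max4PC-twins-relation x y z x≢v y≢z = begin
        max4PC u v y z + max4PC w x y z
          ≡⟨ cong (_+ max4PC w x y z) (U.max4PC-pendant v y z (u≢v ∘ sym) y≢z) ⟩
        suc (max4PC w v y z + max4PC w x y z)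
          ≡⟨ cong (λ t → suc (t + max4PC w x y z)) (max4PC-swap v w y z) ⟩
        suc (max4PC v w y z + max4PC w x y z)
          ≡⟨ sym (ℕ.+-suc (max4PC v w y z) (max4PC w x y z)) ⟩
        max4PC v w y z + suc (max4PC w x y z)
          ≡⟨ cong (max4PC v w y z +_) (sym (V.max4PC-pendant x y z x≢v y≢z)) ⟩
        max4PC v w y z + max4PC v x y z ∎
        where open ≡-Reasoning

module Max4PCMatrix where
  open import Data.Nat as ℕ using (ℕ; zero; suc; _≤_; _⊔_; z≤n; s≤s)
  import Data.Nat.Properties as ℕ
  open import Data.Fin as Fin using (Fin; zero; suc; punchIn; punchOut)
  import Data.Fin.Properties as Fin
  open import Data.Vec.Functional using (_∷_; [])
  open import Data.Rational using (ℚ)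
  open import Data.Product using (∃; ∃₂; _×_; _,_; proj₁; proj₂; uncurry)
  open import Data.Empty using (⊥-elim)
  open import Function using (_∘_)
  open import Relation.Nullary using (¬_; Dec; yes; no; contradiction)
  open import Relation.Nullary.Decidable using (¬?; decidable-stable)
  open import Relation.Binary using (Tri; tri<; tri≈; tri>)
  open import Relation.Binary.PropositionalEquality
  open LinearAlgebra
  open GraphDistance
  open FourPoint

  fresh : ∀ {k n} → k ℕ.< n → (xs : Fin k → Fin n) → ∃ λ x → ∀ i → x ≢ xs i
  fresh {k} {n} k<n xs with Fin.any? (λ x → Fin.all? (λ i → ¬? (x Fin.≟ xs i)))
  ... | yes found = found
  ... | no ¬found = ⊥-elim (no-collision (Fin.pigeonhole k<n (proj₁ ∘ occurs)))
    where
    occurs : ∀ x → ∃ λ i → x ≡ xs i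
    occurs x with Fin.¬∀⟶∃¬ k _ (λ i → ¬? (x Fin.≟ xs i)) (λ x∉xs → ¬found (x , x∉xs))
    ... | i , ¬x≢xsᵢ = i , decidable-stable (x Fin.≟ xs i) ¬x≢xsᵢ
    no-collision : ¬ ∃₂ λ x y → x Fin.< y × proj₁ (occurs x) ≡ proj₁ (occurs y)
    no-collision (x , y , x<y , same) =
      Fin.<⇒≢ x<y (trans (proj₂ (occurs x)) (trans (cong xs same) (sym (proj₂ (occurs y)))))

  mkPair : ∀ {n} → Pair n → Fin n → Fin n → Pair n
  mkPair default i j with i Fin.<? j
  ... | yes i<j = i , j , i<j
  ... | no _    = default

  mkPair-< : ∀ {n} (default : Pair n) i j (i<j : i Fin.< j) → mkPair default i j ≡ (i , j , i<j)
  mkPair-< default i j i<j with i Fin.<? j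
  ... | yes i<j′ = cong (λ lt → i , j , lt) (Fin.<-irrelevant i<j′ i<j)
  ... | no i≮j   = contradiction i<j i≮j

  -- Opaque, so that the type checker never unfolds Fin.remQuot.
  opaque
    pairEnumeration : ∀ {n} → Pair n → Enumeration (Pair n)
    pairEnumeration {n} default = record
      { size            = n ℕ.* n
      ; enum            = λ k → uncurry (mkPair default) (Fin.remQuot n k)
      ; enum-surjective = λ (i , j , i<j) →
          Fin.combine i j ,
          trans (cong (uncurry (mkPair default)) (Fin.remQuot-combine i j)) (mkPair-< default i j i<j)
      }

  punchInPair : ∀ {n} → Fin (suc n) → Pair n → Pair (suc n)
  punchInPair u (i , j , i<j) =
    punchIn u i , punchIn u j ,
    Fin.≤∧≢⇒< (Fin.punchIn-mono-≤ u i j (ℕ.<⇒≤ i<j)) (Fin.<⇒≢ i<j ∘ Fin.punchIn-injective u i j)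

  module TwinLeaves {m} (T : Graph (suc (suc (suc (suc m))))) (connected : Connected T)
                    {u v w} (u≢v : u ≢ v) (u-leaf : LeafAt T u w) (v-leaf : LeafAt T v w) where

    V : Set
    V = Fin (suc (suc (suc (suc m))))

    -- Opaque, so that the type checker never unfolds dist T while comparing rows.
    opaque
      d : V → V → ℕ
      d = dist T

    opaque
      unfolding d
      open Distance T connected

      d-refl : ∀ x → d x x ≡ 0
      d-refl = dist-refl

      d-sym : ∀ x y → d x y ≡ d y x
      d-sym = dist-sym

      d-triangle : ∀ x y z → d x z ≤ d x y ℕ.+ d y z
      d-triangle = dist-triangle

      d-leaf : ∀ {v w} → LeafAt T v w → ∀ y → y ≢ v → d v y ≡ suc (d w y)
      d-leaf = dist-leaf T connected

    open Max4PCProperties Fin._≟_ d d-refl d-sym d-triangle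
    open Twins u≢v (neighbour≢leaf T u-leaf) (neighbour≢leaf T v-leaf) (d-leaf u-leaf) (d-leaf v-leaf)

    opaque
      unfolding d
      Max4PC≡max4PC : ∀ p q → Max4PC T p q ≡ max4PC (proj₁ p) (proj₁ (proj₂ p)) (proj₁ q) (proj₁ (proj₂ q))
      Max4PC≡max4PC _ _ = refl

    ι : Pair (suc (suc (suc m))) → Pair (suc (suc (suc (suc m))))
    ι = punchInPair u

    pairs : Enumeration (Pair (suc (suc (suc m))))
    pairs = pairEnumeration (zero , suc zero , s≤s z≤n)
    open Enumeration pairs

    avoiding : Fin size → Pair (suc (suc (suc (suc m)))) → ℚ
    avoiding = row (Max4PC T) ∘ ι ∘ enum

    rowAt : V → V → Pair (suc (suc (suc (suc m)))) → ℚ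
    rowAt a b (y , z , _) = toℚ (max4PC a b y z)

    ι-∈Span : ∀ a′ b′ (a′<b′ : a′ Fin.< b′) → rowAt (punchIn u a′) (punchIn u b′) ∈Span avoiding
    ι-∈Span a′ b′ a′<b′ = ∈Span-cong (λ q → cong toℚ (Max4PC≡max4PC (ι p) q))
      (subst (λ p → row (Max4PC T) (ι p) ∈Span avoiding) (proj₂ (enum-surjective p))
             (generator-∈Span avoiding (proj₁ (enum-surjective p))))
      where p = (a′ , b′ , a′<b′)

    rowAt-avoiding : ∀ a b → a ≢ b → u ≢ a → u ≢ b → rowAt a b ∈Span avoiding
    rowAt-avoiding a b a≢b u≢a u≢b = by-order (Fin.<-cmp (punchOut u≢a) (punchOut u≢b))
      where
      a′ = punchOut u≢a
      b′ = punchOut u≢b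
      by-order : Tri (a′ Fin.< b′) (a′ ≡ b′) (b′ Fin.< a′) → rowAt a b ∈Span avoiding
      by-order (tri< a′<b′ _ _) =
        subst₂ (λ a b → rowAt a b ∈Span avoiding) (Fin.punchIn-punchOut u≢a) (Fin.punchIn-punchOut u≢b)
               (ι-∈Span a′ b′ a′<b′)
      by-order (tri≈ _ a′≡b′ _) = ⊥-elim (a≢b (Fin.punchOut-injective u≢a u≢b a′≡b′))
      by-order (tri> _ _ b′<a′) =
        ∈Span-cong (λ (y , z , _) → cong toℚ (max4PC-swap a b y z))
          (subst₂ (λ a b → rowAt b a ∈Span avoiding) (Fin.punchIn-punchOut u≢a) (Fin.punchIn-punchOut u≢b)
                  (ι-∈Span b′ a′ b′<a′))

    rowAt-leaf : ∀ b → u ≢ b → Dec (v ≡ b) → rowAt u b ∈Span avoiding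
    rowAt-leaf b u≢b (no v≢b) =
      ∈Span-cong (λ (y , z , y<z) → cong toℚ (sym (max4PC-twins b y z (u≢b ∘ sym) (v≢b ∘ sym) (Fin.<⇒≢ y<z))))
                 (rowAt-avoiding v b v≢b u≢v u≢b)
    rowAt-leaf _ _ (yes refl) =
      ∈Span-cong (λ (y , z , y<z) → sym (toℚ-cancel (max4PC u v y z) (max4PC v w y z) (max4PC v x y z) (max4PC w x y z)
                                          (max4PC-twins-relation x y z x≢v (Fin.<⇒≢ y<z))))
                 (∈Span-- (∈Span-+ (rowAt-avoiding v w (w≢v ∘ sym) u≢v (w≢u ∘ sym))
                                   (rowAt-avoiding v x (x≢v ∘ sym) u≢v (x≢u ∘ sym)))
                          (rowAt-avoiding w x (x≢w ∘ sym) (w≢u ∘ sym) (x≢u ∘ sym)))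
      where
      w≢u = neighbour≢leaf T u-leaf
      w≢v = neighbour≢leaf T v-leaf
      fourth = fresh (s≤s (s≤s (s≤s (s≤s z≤n)))) (u ∷ v ∷ w ∷ [])
      x = proj₁ fourth
      x≢u = proj₂ fourth zero
      x≢v = proj₂ fourth (suc zero)
      x≢w = proj₂ fourth (suc (suc zero))

    rowAt-∈Span : ∀ a b → a ≢ b → Dec (u ≡ a) → Dec (u ≡ b) → rowAt a b ∈Span avoiding
    rowAt-∈Span a b a≢b (yes refl) (yes refl) = ⊥-elim (a≢b refl)
    rowAt-∈Span a b a≢b (yes refl) (no u≢b)   = rowAt-leaf b u≢b (v Fin.≟ b)
    rowAt-∈Span a b a≢b (no u≢a)   (yes refl) =
      ∈Span-cong (λ (y , z , _) → cong toℚ (max4PC-swap a u y z)) (rowAt-leaf a u≢a (v Fin.≟ a))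
    rowAt-∈Span a b a≢b (no u≢a)   (no u≢b)   = rowAt-avoiding a b a≢b u≢a u≢b

    row-∈Span : ∀ p → row (Max4PC T) p ∈Span avoiding
    row-∈Span p@(a , b , a<b) =
      ∈Span-cong (λ q → cong toℚ (sym (Max4PC≡max4PC p q))) (rowAt-∈Span a b (Fin.<⇒≢ a<b) (u Fin.≟ a) (u Fin.≟ b))

    Max4PC-sym : ∀ p q → Max4PC T p q ≡ Max4PC T q p
    Max4PC-sym p q = trans (Max4PC≡max4PC p q) (trans (max4PC-comm _ _ _ _) (sym (Max4PC≡max4PC q p)))

    Max4PC-delete : ∀ p q → Max4PC (delete T u) p q ≡ Max4PC T (ι p) (ι q)
    Max4PC-delete (a , b , _) (y , z , _) =
      cong₂ _⊔_ (cong₂ _⊔_ (cong₂ ℕ._+_ (δ a b) (δ y z)) (cong₂ ℕ._+_ (δ a y) (δ b z)))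
                (cong₂ ℕ._+_ (δ a z) (δ b y))
      where δ = dist-delete T connected u-leaf

    rank-delete : ∀ {r} → HasRank (Max4PC T) r → HasRank (Max4PC (delete T u)) r
    rank-delete = HasRank-principalSubmatrix pairs (Max4PC T) (Max4PC (delete T u)) ι
                    Max4PC-delete Max4PC-sym row-∈Span

open LinearAlgebra using (rank-exists)
open Max4PCMatrix using (pairEnumeration; module TwinLeaves)

corollary4p1 : ∀ (m : ℕ) → 3 ≤ m → (T : Graph (suc m)) → IsTree T →
    (u v w : Fin (suc m)) → u ≢ v → LeafAt T u w → LeafAt T v w →
    ∃ λ r → HasRank (Max4PC T) r × HasRank (Max4PC (delete T u)) r
      × HasRank (Max4PC (delete T v)) r
corollary4p1 (suc (suc (suc m))) (s≤s (s≤s (s≤s _))) T (connected , _) u v w u≢v u-leaf v-leaf =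
  let r , rank-T = rank-exists (pairEnumeration (zero , suc zero , s≤s z≤n)) (Max4PC T)
  in  r , rank-T , TwinLeaves.rank-delete T connected u≢v u-leaf v-leaf rank-T
               , TwinLeaves.rank-delete T connected (u≢v ∘ sym) v-leaf u-leaf rank-T
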